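{- Let $r\geq 3$ be an integer, let $G$ be a triangle-free $4$-sunspot-free graph, and let $(L_0,\ldots,L_r)$ be an $r$-leveling in $G$ such that $G[L_r]$ is liberal. Let $H$ be a hole of length at least $6$ in $G[L_r]$ and let $x\in L_r\setminus V(H)$. Then there is no $x$-sector of length at most $2$ in $H$.
   Context: Graphs are finite and simple. A $4$-sunspot in $G$ is a $7$-tuple $(x_1,x_2,x_3,x_4;y_1,y_2,y_3)$ of pairwise distinct vertices such that the edges of $G$ among them are exactly $x_1x_2,x_2x_3,x_3x_4,x_4x_1,x_1y_1,x_2y_2,x_3y_3$; $G$ is $4$-sunspot-free if none exists. An $r$-leveling in $G$ is a tuple $(L_0,\ldots,L_r)$ of pairwise disjoint nonempty vertex subsets such that every vertex of $L_i$ ($1\le i\le r$) has a neighbor in $L_{i-1}$, and any edge between $L_i$ and $L_j$ with $i\neq j$ has $|i-j|=1$. A graph is liberal if for all distinct non-adjacent vertices $x,y$, both $N(x)\setminus N(y)$ and $N(y)\setminus N(x)$ are nonempty. A hole is an induced cycle on at least four vertices, its length being its number of edges. A path in $G$ is an induced subgraph that is a path; its length is its number of edges, its interior is the set of non-end vertices. For a hole $H$ and a vertex $x\notin H$, an $x$-sector in $H$ is a path of nonzero length in $H$ whose two ends are adjacent to $x$ and whose interior vertices are all non-adjacent to $x$. -}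

module Defs where

open import Data.Nat using (ℕ; zero; suc; _≤_; _<_)
open import Data.Fin using (Fin; toℕ; inject₁; fromℕ)
open import Data.Bool using (Bool; true; false)
open import Data.Product using (Σ; ∃; _×_; _,_)
open import Data.Sum using (_⊎_)
open import Data.Empty using (⊥)
open import Relation.Nullary using (¬_)
open import Relation.Binary.PropositionalEquality using (_≡_; _≢_)
open import Function.Definitions using (Injective)

_⇔_ : Set → Set → Set
A ⇔ B = (A → B) × (B → A)

record Graph : Set where
  field
    n     : ℕ
    adj   : Fin n → Fin n → Bool
    sym   : ∀ u v → adj u v ≡ adj v u
    irr   : ∀ v → adj v v ≡ false

module _ (G : Graph) where
  open Graph G

  V : Set
  V = Fin n

  Adj : V → V → Set
  Adj u v = adj u v ≡ true

  TriangleFree : Set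
  TriangleFree = ∀ a b c → Adj a b → Adj b c → Adj a c → ⊥

-- The edge pattern of a 4-sunspot (x1,x2,x3,x4;y1,y2,y3) indexed by Fin 7:
-- 0,1,2,3 = x1..x4 ; 4,5,6 = y1,y2,y3.
-- Edges: x1x2, x2x3, x3x4, x4x1, x1y1, x2y2, x3y3.
sunEdge : ℕ → ℕ → Bool
sunEdge 0 1 = true
sunEdge 1 2 = true
sunEdge 2 3 = true
sunEdge 3 0 = true
sunEdge 0 4 = true
sunEdge 1 5 = true
sunEdge 2 6 = true
sunEdge _ _ = false

sunPattern : Fin 7 → Fin 7 → Bool
sunPattern i j = Data.Bool._∨_ (sunEdge (toℕ i) (toℕ j)) (sunEdge (toℕ j) (toℕ i))

module _ (G : Graph) where
  open Graph G

  Sunspot4 : (Fin 7 → V G) → Set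
  Sunspot4 s = Injective _≡_ _≡_ s × (∀ i j → (i ≢ j) → adj (s i) (s j) ≡ sunPattern i j)

  SunspotFree4 : Set
  SunspotFree4 = ∀ (s : Fin 7 → V G) → ¬ Sunspot4 s

  record Leveling (r : ℕ) (L : Fin (suc r) → V G → Set) : Set where
    field
      disjoint : ∀ i j v → i ≢ j → L i v → L j v → ⊥
      nonempty : ∀ i → ∃ λ v → L i v
      parent   : ∀ (i : Fin r) v → L (Data.Fin.suc i) v →
                   ∃ λ u → L (inject₁ i) u × Adj G v u
      consecutive : ∀ i j u v → i ≢ j → L i u → L j v → Adj G u v →
                   (suc (toℕ i) ≡ toℕ j ⊎ suc (toℕ j) ≡ toℕ i)

  Liberal : (V G → Set) → Set
  Liberal S = ∀ x y → S x → S y → x ≢ y → ¬ Adj G x y →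
      (∃ λ z → S z × Adj G x z × ¬ Adj G y z)
    × (∃ λ z → S z × Adj G y z × ¬ Adj G x z)

CycAdj : (k : ℕ) → Fin k → Fin k → Set
CycAdj k i j = suc (toℕ i) ≡ toℕ j ⊎ suc (toℕ j) ≡ toℕ i
             ⊎ (toℕ i ≡ 0 × suc (toℕ j) ≡ k) ⊎ (toℕ j ≡ 0 × suc (toℕ i) ≡ k)

PathAdj : (m : ℕ) → Fin (suc m) → Fin (suc m) → Set
PathAdj m i j = suc (toℕ i) ≡ toℕ j ⊎ suc (toℕ j) ≡ toℕ i

module _ (G : Graph) where

  record Hole : Set where
    field
      len     : ℕ
      len≥4   : 4 ≤ len
      vtx     : Fin len → V G
      inj     : Injective _≡_ _≡_ vtx
      induced : ∀ i j → Adj G (vtx i) (vtx j) ⇔ CycAdj len i j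

  InHole : Hole → V G → Set
  InHole H v = ∃ λ i → Hole.vtx H i ≡ v

  record Path : Set where
    field
      len     : ℕ
      vtx     : Fin (suc len) → V G
      inj     : Injective _≡_ _≡_ vtx
      induced : ∀ i j → Adj G (vtx i) (vtx j) ⇔ PathAdj len i j

  IsSector : V G → Hole → Path → Set
  IsSector x H P =
      1 ≤ Path.len P
    × (∀ i → InHole H (Path.vtx P i))
    × Adj G x (Path.vtx P Data.Fin.zero)
    × Adj G x (Path.vtx P (fromℕ (Path.len P)))
    × (∀ i → 0 < toℕ i → toℕ i < Path.len P → ¬ Adj G x (Path.vtx P i))

-- A sector of length 1 is a triangle.  A sector of length 2 means that x sees
-- both hole-neighbours w₃, w₅ of a hole vertex w₄ but not w₄ itself; look at the
-- nine consecutive hole vertices w₀ … w₈ around w₄ (any five consecutive ones induce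
-- a path).
-- Every vertex of L_r has a neighbour in L_{r-1}, and every vertex of L_{r-1} has
-- a neighbour in L_{r-2}, which has no neighbour in L_r.  With triangle-freeness
-- this makes a 4-sunspot out of any vertex of L_{r-1} seeing two hole vertices at
-- distance two, and forces a vertex of L_r that skips a hole vertex to see all of
-- its neighbours in L_{r-1}.  Liberality of G[L_r] gives z ∈ L_r seeing w₄ but not
-- x, and u ∈ L_r seeing x but not w₄.  Then u sees z, z misses w₂ and w₆ (by one
-- argument applied in both directions along the hole), and
-- (w₃, w₄, w₅, x; w₂, z, w₆) is a 4-sunspot.

module Submission where

open import Defs
open import Data.Nat using (ℕ; zero; suc; _+_; _*_; _∸_; _≤_; _<_; z≤n; s≤s; z<s; NonZero; >-nonZero; _%_; _/_)
open import Data.Nat.Properties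
  using (+-commutativeSemigroup; +-assoc; +-comm; +-suc; +-cancelʳ-≡; +-cancelʳ-<; +-mono-<; +-monoʳ-≤;
         ≤-trans; ≤-<-trans; ≤-antisym; ≤-total; <-trans; <-irrefl; <-asym; <⇒≢; ≮⇒≥; _<?_; n<1+n;
         ∸-+-assoc; m+[n∸m]≡n; m+n≤o⇒m≤o∸n; m∸n+n≡m; m∸n≤m)
open import Algebra.Properties.CommutativeSemigroup +-commutativeSemigroup using (x∙yz≈y∙xz)
open import Data.Nat.DivMod using (_mod_; m%n<n; m<n⇒m%n≡m; [m+kn]%n≡m%n; m≡m%n+[m/n]*n; n%n≡0; [m+n]%n≡m%n; m≤n⇒[n∸m]%m≡n%m)
open import Data.Fin using (Fin; toℕ; fromℕ; fromℕ<; inject₁; Fin′; inject)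
  renaming (zero to fzero; suc to fsuc; _≟_ to _≟ᶠ_; _<_ to _<ᶠ_)
open import Data.Fin.Properties using (toℕ-fromℕ<; toℕ<n; toℕ-injective; toℕ-inject; toℕ-inject₁; toℕ-fromℕ; any?; all?)
  renaming (<-cmp to <ᶠ-cmp)
open import Data.Bool using (Bool; true)
open import Data.Bool.Properties using (∨-comm; ¬-not) renaming (_≟_ to _≟ᵇ_)
open import Data.Vec using (_∷_; []; lookup)
open import Data.Product using (∃; _×_; _,_; proj₁; proj₂)
open import Data.Sum using (_⊎_; inj₁; inj₂)
open import Data.Empty using (⊥; ⊥-elim)
open import Relation.Nullary using (¬_; ¬?; Dec; yes; no; contradiction)
open import Relation.Nullary.Decidable using (True; toWitness; decidable-stable; _×-dec_; _⊎-dec_)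
open import Relation.Binary using (tri<; tri≈; tri>)
open import Relation.Binary.PropositionalEquality
open import Function using (_∘_; case_of_)
open import Function.Definitions using (Injective)

-- Bounds on concrete window positions, such as 2 + 3 ≤ 8, are found by instance search.
instance
  ≤-zero : ∀ {n} → zero ≤ n
  ≤-zero = z≤n

  ≤-suc : ∀ {m n} → {{m ≤ n}} → suc m ≤ suc n
  ≤-suc {{m≤n}} = s≤s m≤n

d+[m∸[d+i]]≡m∸i : ∀ {m} d i → d + i ≤ m → d + (m ∸ (d + i)) ≡ m ∸ i
d+[m∸[d+i]]≡m∸i {m} d i d+i≤m = begin
  d + (m ∸ (d + i))  ≡⟨ cong (λ j → d + (m ∸ j)) (+-comm d i) ⟩
  d + (m ∸ (i + d))  ≡⟨ cong (d +_) (sym (∸-+-assoc m i d)) ⟩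
  d + (m ∸ i ∸ d)    ≡⟨ m+[n∸m]≡n (m+n≤o⇒m≤o∸n d d+i≤m) ⟩
  m ∸ i              ∎
  where open ≡-Reasoning

module Cyclic (k : ℕ) .{{_ : NonZero k}} where
  open ≡-Reasoning

  [d+n%k]%k≡[d+n]%k : ∀ d n → (d + n % k) % k ≡ (d + n) % k
  [d+n%k]%k≡[d+n]%k d n = sym (begin
    (d + n) % k                    ≡⟨ cong (λ n → (d + n) % k) (m≡m%n+[m/n]*n n k) ⟩
    (d + (n % k + n / k * k)) % k  ≡⟨ cong (_% k) (sym (+-assoc d (n % k) _)) ⟩
    (d + n % k + n / k * k) % k    ≡⟨ [m+kn]%n≡m%n (d + n % k) (n / k) k ⟩
    (d + n % k) % k                ∎)

  [t+a]%k≡a⇒t≡0 : ∀ {t a} → t < k → a < k → (t + a) % k ≡ a → t ≡ 0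
  [t+a]%k≡a⇒t≡0 {t} {a} t<k a<k eq with t + a <? k
  ... | yes t+a<k = +-cancelʳ-≡ a t 0 (trans (sym (m<n⇒m%n≡m t+a<k)) eq)
  ... | no t+a≮k = contradiction t≡k (<⇒≢ t<k)
    where
      k≤t+a : k ≤ t + a
      k≤t+a = ≮⇒≥ t+a≮k
      r+k≡t+a : (t + a ∸ k) + k ≡ t + a
      r+k≡t+a = m∸n+n≡m k≤t+a
      r<k : t + a ∸ k < k
      r<k = +-cancelʳ-< k _ k (subst (_< k + k) (sym r+k≡t+a) (+-mono-< t<k a<k))
      r≡a : t + a ∸ k ≡ a
      r≡a = begin
        t + a ∸ k        ≡⟨ sym (m<n⇒m%n≡m r<k) ⟩
        (t + a ∸ k) % k  ≡⟨ m≤n⇒[n∸m]%m≡n%m k≤t+a ⟩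
        (t + a) % k      ≡⟨ eq ⟩
        a                ∎
      t≡k : t ≡ k
      t≡k = +-cancelʳ-≡ a t k (trans (sym r+k≡t+a) (trans (cong (_+ k) r≡a) (+-comm a k)))

  +-cancelʳ-% : ∀ n {d e} → d < k → e < k → (d + n) % k ≡ (e + n) % k → d ≡ e
  +-cancelʳ-% n {d} {e} d<k e<k eq =
    case ≤-total d e of λ
      { (inj₁ d≤e) → cancel-≤ d≤e e<k eq
      ; (inj₂ e≤d) → sym (cancel-≤ e≤d d<k (sym eq))
      }
    where
      cancel-≤ : ∀ {d e} → d ≤ e → e < k → (d + n) % k ≡ (e + n) % k → d ≡ e
      cancel-≤ {d} {e} d≤e e<k eq = sym (begin
        e          ≡⟨ sym (m∸n+n≡m d≤e) ⟩
        e ∸ d + d  ≡⟨ cong (_+ d) e∸d≡0 ⟩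
        d          ∎)
        where
          e∸d≡0 : e ∸ d ≡ 0
          e∸d≡0 = [t+a]%k≡a⇒t≡0 (≤-<-trans (m∸n≤m e d) e<k) (m%n<n (d + n) k) (begin
            (e ∸ d + (d + n) % k) % k  ≡⟨ [d+n%k]%k≡[d+n]%k (e ∸ d) (d + n) ⟩
            (e ∸ d + (d + n)) % k      ≡⟨ cong (_% k) (sym (+-assoc (e ∸ d) d n)) ⟩
            (e ∸ d + d + n) % k        ≡⟨ cong (λ e → (e + n) % k) (m∸n+n≡m d≤e) ⟩
            (e + n) % k                ≡⟨ sym eq ⟩
            (d + n) % k                ∎)

  ι : ℕ → Fin k
  ι n = n mod k

  toℕ-ι : ∀ n → toℕ (ι n) ≡ n % k
  toℕ-ι n = toℕ-fromℕ< (m%n<n n k)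

  ι-toℕ : ∀ i → ι (toℕ i) ≡ i
  ι-toℕ i = toℕ-injective (trans (toℕ-ι (toℕ i)) (m<n⇒m%n≡m (toℕ<n i)))

  ι-periodic : ∀ n → ι (n + k) ≡ ι n
  ι-periodic n = toℕ-injective (trans (toℕ-ι (n + k)) (trans ([m+n]%n≡m%n n k) (sym (toℕ-ι n))))

  ι-cancelʳ : ∀ n {d e} → d < k → e < k → ι (d + n) ≡ ι (e + n) → d ≡ e
  ι-cancelʳ n d<k e<k eq =
    +-cancelʳ-% n d<k e<k (trans (sym (toℕ-ι _)) (trans (cong toℕ eq) (toℕ-ι _)))

  next : Fin k → Fin k
  next i = ι (suc (toℕ i))

  ι-suc : ∀ n → ι (suc n) ≡ next (ι n)
  ι-suc n = toℕ-injective (begin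
    toℕ (ι (suc n))       ≡⟨ toℕ-ι (suc n) ⟩
    suc n % k             ≡⟨ sym ([d+n%k]%k≡[d+n]%k 1 n) ⟩
    suc (n % k) % k       ≡⟨ cong (λ m → suc m % k) (sym (toℕ-ι n)) ⟩
    suc (toℕ (ι n)) % k   ≡⟨ sym (toℕ-ι _) ⟩
    toℕ (next (ι n))      ∎)

  next-injective : ∀ {i j} → next i ≡ next j → i ≡ j
  next-injective {i} {j} eq = toℕ-injective (ι-cancelʳ 1 (toℕ<n i) (toℕ<n j) (begin
    ι (toℕ i + 1)  ≡⟨ cong ι (+-comm (toℕ i) 1) ⟩
    next i         ≡⟨ eq ⟩
    next j         ≡⟨ cong ι (+-comm 1 (toℕ j)) ⟩
    ι (toℕ j + 1)  ∎))

  next-of-% : ∀ {i j} → suc (toℕ i) % k ≡ toℕ j → next i ≡ j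
  next-of-% e = toℕ-injective (trans (toℕ-ι _) e)

  next-of-suc : ∀ {i j} → suc (toℕ i) ≡ toℕ j → next i ≡ j
  next-of-suc {j = j} e = next-of-% (trans (cong (_% k) e) (m<n⇒m%n≡m (toℕ<n j)))

  next-of-last : ∀ {i j} → suc (toℕ i) ≡ k → toℕ j ≡ 0 → next i ≡ j
  next-of-last e j≡0 = next-of-% (trans (cong (_% k) e) (trans (n%n≡0 k) (sym j≡0)))

  CycAdj-next : ∀ i → CycAdj k i (next i)
  CycAdj-next i with suc (toℕ i) <? k
  ... | yes i+1<k = inj₁ (sym (trans (toℕ-ι _) (m<n⇒m%n≡m i+1<k)))
  ... | no i+1≮k = inj₂ (inj₂ (inj₂ (trans (toℕ-ι _) (trans (cong (_% k) i+1≡k) (n%n≡0 k)) , i+1≡k)))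
    where
      i+1≡k : suc (toℕ i) ≡ k
      i+1≡k = ≤-antisym (toℕ<n i) (≮⇒≥ i+1≮k)

  CycAdj⇒next : ∀ {i j} → CycAdj k i j → j ≡ next i ⊎ i ≡ next j
  CycAdj⇒next (inj₁ e) = inj₁ (sym (next-of-suc e))
  CycAdj⇒next (inj₂ (inj₁ e)) = inj₂ (sym (next-of-suc e))
  CycAdj⇒next (inj₂ (inj₂ (inj₁ (i≡0 , e)))) = inj₂ (sym (next-of-last e i≡0))
  CycAdj⇒next (inj₂ (inj₂ (inj₂ (j≡0 , e)))) = inj₁ (sym (next-of-last e j≡0))

module _ {m : ℕ} (p : Fin m → Fin m → Bool) where

  Separated : Fin m → Fin m → Set
  Separated i j = p i j ≡ true ⊎ ∃ λ l → l ≢ i × l ≢ j × p i l ≢ p j l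

  separated? : ∀ i j → Dec (Separated i j)
  separated? i j = (p i j ≟ᵇ true) ⊎-dec any? λ l → ¬? (l ≟ᶠ i) ×-dec ¬? (l ≟ᶠ j) ×-dec ¬? (p i l ≟ᵇ p j l)

  TwinFree : Set
  TwinFree = ∀ i j → i ≢ j → Separated i j

  twinFree-by-computation : True (all? λ i → all? λ j → (i ≟ᶠ j) ⊎-dec separated? i j) → TwinFree
  twinFree-by-computation ok i j i≢j with toWitness ok i j
  ... | inj₁ i≡j = contradiction i≡j i≢j
  ... | inj₂ separated = separated

  Symmetric : Set
  Symmetric = ∀ i j → p i j ≡ p j i

sunPattern-twinFree : TwinFree sunPattern
sunPattern-twinFree = twinFree-by-computation sunPattern _

sunPattern-symmetric : Symmetric sunPattern
sunPattern-symmetric i j = ∨-comm (sunEdge (toℕ i) (toℕ j)) _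

inject-fromℕ< : ∀ {m} {i j : Fin m} (i<j : i <ᶠ j) → inject (fromℕ< i<j) ≡ i
inject-fromℕ< i<j = toℕ-injective (trans (toℕ-inject _) (toℕ-fromℕ< i<j))

module _ (G : Graph) where
  open Graph G using (adj; irr)

  ¬Adj-refl : ∀ {v} → ¬ Adj G v v
  ¬Adj-refl {v} loop with trans (sym loop) (irr v)
  ... | ()

  Adj-sym : ∀ {u v} → Adj G u v → Adj G v u
  Adj-sym {u} {v} uv = trans (Graph.sym G v u) uv

  ¬Adj-sym : ∀ {u v} → ¬ Adj G u v → ¬ Adj G v u
  ¬Adj-sym ¬uv vu = ¬uv (Adj-sym vu)

  Adj? : ∀ u v → Dec (Adj G u v)
  Adj? u v = adj u v ≟ᵇ true

  Realises : ∀ {m} → (Fin m → V G) → (Fin m → Fin m → Bool) → Set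
  Realises s p = ∀ i j → i ≢ j → adj (s i) (s j) ≡ p i j

  -- This is why the seven vertices of a sunspot never have to be shown distinct.
  realisation-injective : ∀ {m} {p : Fin m → Fin m → Bool} {s : Fin m → V G} →
                          TwinFree p → Realises s p → Injective _≡_ _≡_ s
  realisation-injective {p = p} {s} twinFree realises {i} {j} si≡sj with i ≟ᶠ j
  ... | yes i≡j = i≡j
  ... | no i≢j with twinFree i j i≢j
  ... | inj₁ pij = ⊥-elim (¬Adj-refl (subst (λ v → Adj G v (s j)) si≡sj (trans (realises i j i≢j) pij)))
  ... | inj₂ (l , l≢i , l≢j , differ) = ⊥-elim (differ (begin
    p i l            ≡⟨ sym (realises i l (l≢i ∘ sym)) ⟩
    adj (s i) (s l)  ≡⟨ cong (λ v → adj v (s l)) si≡sj ⟩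
    adj (s j) (s l)  ≡⟨ realises j l (l≢j ∘ sym) ⟩
    p j l            ∎))
    where open ≡-Reasoning

  realises-from-below : ∀ {m} {p : Fin m → Fin m → Bool} {s : Fin m → V G} → Symmetric p →
                        (∀ j (i : Fin′ j) → adj (s (inject i)) (s j) ≡ p (inject i) j) → Realises s p
  realises-from-below {p = p} {s} p-sym below i j i≢j with <ᶠ-cmp i j
  ... | tri< i<j _ _ = subst (λ i → adj (s i) (s j) ≡ p i j) (inject-fromℕ< i<j) (below j (fromℕ< i<j))
  ... | tri≈ _ i≡j _ = contradiction i≡j i≢j
  ... | tri> _ _ j<i = begin
    adj (s i) (s j)  ≡⟨ Graph.sym G (s i) (s j) ⟩
    adj (s j) (s i)  ≡⟨ subst (λ j → adj (s j) (s i) ≡ p j i) (inject-fromℕ< j<i) (below i (fromℕ< j<i)) ⟩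
    p j i            ≡⟨ p-sym j i ⟩
    p i j            ∎
    where open ≡-Reasoning

  no-sunspot : SunspotFree4 G → ∀ x₁ x₂ x₃ x₄ y₁ y₂ y₃ →
    Adj G x₁ x₂ → Adj G x₂ x₃ → Adj G x₃ x₄ → Adj G x₄ x₁ →
    Adj G x₁ y₁ → Adj G x₂ y₂ → Adj G x₃ y₃ →
    ¬ Adj G x₁ x₃ → ¬ Adj G x₂ x₄ →
    ¬ Adj G x₁ y₂ → ¬ Adj G x₁ y₃ → ¬ Adj G x₂ y₁ → ¬ Adj G x₂ y₃ → ¬ Adj G x₃ y₁ → ¬ Adj G x₃ y₂ →
    ¬ Adj G x₄ y₁ → ¬ Adj G x₄ y₂ → ¬ Adj G x₄ y₃ →
    ¬ Adj G y₁ y₂ → ¬ Adj G y₁ y₃ → ¬ Adj G y₂ y₃ → ⊥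
  no-sunspot sunspot-free x₁ x₂ x₃ x₄ y₁ y₂ y₃ x₁x₂ x₂x₃ x₃x₄ x₄x₁ x₁y₁ x₂y₂ x₃y₃
             x₁x₃ x₂x₄ x₁y₂ x₁y₃ x₂y₁ x₂y₃ x₃y₁ x₃y₂ x₄y₁ x₄y₂ x₄y₃ y₁y₂ y₁y₃ y₂y₃ =
    sunspot-free s (realisation-injective sunPattern-twinFree realises , realises)
    where
      s : Fin 7 → V G
      s = lookup (x₁ ∷ x₂ ∷ x₃ ∷ x₄ ∷ y₁ ∷ y₂ ∷ y₃ ∷ [])

      below : ∀ j (i : Fin′ j) → adj (s (inject i)) (s j) ≡ sunPattern (inject i) j
      below (fsuc fzero) fzero = x₁x₂
      below (fsuc (fsuc fzero)) fzero = ¬-not x₁x₃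
      below (fsuc (fsuc fzero)) (fsuc fzero) = x₂x₃
      below (fsuc (fsuc (fsuc fzero))) fzero = Adj-sym x₄x₁
      below (fsuc (fsuc (fsuc fzero))) (fsuc fzero) = ¬-not x₂x₄
      below (fsuc (fsuc (fsuc fzero))) (fsuc (fsuc fzero)) = x₃x₄
      below (fsuc (fsuc (fsuc (fsuc fzero)))) fzero = x₁y₁
      below (fsuc (fsuc (fsuc (fsuc fzero)))) (fsuc fzero) = ¬-not x₂y₁
      below (fsuc (fsuc (fsuc (fsuc fzero)))) (fsuc (fsuc fzero)) = ¬-not x₃y₁
      below (fsuc (fsuc (fsuc (fsuc fzero)))) (fsuc (fsuc (fsuc fzero))) = ¬-not x₄y₁
      below (fsuc (fsuc (fsuc (fsuc (fsuc fzero))))) fzero = ¬-not x₁y₂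
      below (fsuc (fsuc (fsuc (fsuc (fsuc fzero))))) (fsuc fzero) = x₂y₂
      below (fsuc (fsuc (fsuc (fsuc (fsuc fzero))))) (fsuc (fsuc fzero)) = ¬-not x₃y₂
      below (fsuc (fsuc (fsuc (fsuc (fsuc fzero))))) (fsuc (fsuc (fsuc fzero))) = ¬-not x₄y₂
      below (fsuc (fsuc (fsuc (fsuc (fsuc fzero))))) (fsuc (fsuc (fsuc (fsuc fzero)))) = ¬-not y₁y₂
      below (fsuc (fsuc (fsuc (fsuc (fsuc (fsuc fzero)))))) fzero = ¬-not x₁y₃
      below (fsuc (fsuc (fsuc (fsuc (fsuc (fsuc fzero)))))) (fsuc fzero) = ¬-not x₂y₃
      below (fsuc (fsuc (fsuc (fsuc (fsuc (fsuc fzero)))))) (fsuc (fsuc fzero)) = x₃y₃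
      below (fsuc (fsuc (fsuc (fsuc (fsuc (fsuc fzero)))))) (fsuc (fsuc (fsuc fzero))) = ¬-not x₄y₃
      below (fsuc (fsuc (fsuc (fsuc (fsuc (fsuc fzero)))))) (fsuc (fsuc (fsuc (fsuc fzero)))) = ¬-not y₁y₃
      below (fsuc (fsuc (fsuc (fsuc (fsuc (fsuc fzero)))))) (fsuc (fsuc (fsuc (fsuc (fsuc fzero))))) = ¬-not y₂y₃

      realises : Realises s sunPattern
      realises = realises-from-below sunPattern-symmetric below

  -- Positions 0 … m of a walk along a hole of length at least 6 inside R, so that any
  -- five consecutive positions induce a path; `at` is junk beyond m.
  record Window (R : V G → Set) (m : ℕ) : Set where
    field
      at   : ℕ → V G
      inR  : ∀ i → {{i ≤ m}} → R (at i)
      step : ∀ i → {{suc i ≤ m}} → Adj G (at i) (at (suc i))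
      gap  : ∀ i d → {{2 ≤ d}} → {{d ≤ 4}} → {{d + i ≤ m}} → ¬ Adj G (at i) (at (d + i))

  module _ {R : V G → Set} where

    reverse : ∀ {m} → Window R m → Window R m
    reverse {m} W = record
      { at   = λ i → at (m ∸ i)
      ; inR  = λ i → inR (m ∸ i) {{m∸n≤m m i}}
      ; step = λ i {{i<m}} → Adj-sym (subst (λ j → Adj G (at (m ∸ suc i)) (at j)) (d+[m∸[d+i]]≡m∸i 1 i i<m)
                                       (step (m ∸ suc i) {{bound 1 i i<m}}))
      ; gap  = λ i d {{2≤d}} {{d≤4}} {{d+i≤m}} →
                 ¬Adj-sym (subst (λ j → ¬ Adj G (at (m ∸ (d + i))) (at j)) (d+[m∸[d+i]]≡m∸i d i d+i≤m)
                            (gap (m ∸ (d + i)) d {{2≤d}} {{d≤4}} {{bound d i d+i≤m}}))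
      }
      where
        open Window W
        bound : ∀ d i → d + i ≤ m → d + (m ∸ (d + i)) ≤ m
        bound d i d+i≤m = subst (_≤ m) (sym (d+[m∸[d+i]]≡m∸i d i d+i≤m)) (m∸n≤m m i)

    subwindow : ∀ {m n} (c : ℕ) → Window R n → {{c + m ≤ n}} → Window R m
    subwindow {m} {n} c W {{c+m≤n}} = record
      { at   = λ i → at (c + i)
      ; inR  = λ i {{i≤m}} → inR (c + i) {{within i≤m}}
      ; step = λ i {{i<m}} → subst (λ j → Adj G (at (c + i)) (at j)) (sym (+-suc c i))
                               (step (c + i) {{subst (_≤ n) (+-suc c i) (within i<m)}})
      ; gap  = λ i d {{2≤d}} {{d≤4}} {{d+i≤m}} → subst (λ j → ¬ Adj G (at (c + i)) (at j)) (x∙yz≈y∙xz d c i)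
                 (gap (c + i) d {{2≤d}} {{d≤4}} {{subst (_≤ n) (sym (x∙yz≈y∙xz d c i)) (within d+i≤m)}})
      }
      where
        open Window W
        within : ∀ {j} → j ≤ m → c + j ≤ n
        within j≤m = ≤-trans (+-monoʳ-≤ c j≤m) c+m≤n

  WindowThrough : (V G → Set) → V G → V G → V G → Set
  WindowThrough R u v w = ∃ λ (W : Window R 8) → let open Window W in at 3 ≡ u × at 4 ≡ v × at 5 ≡ w

  flip-window : ∀ {R u v w} → WindowThrough R u v w → WindowThrough R w v u
  flip-window (W , at₃ , at₄ , at₅) = reverse W , at₅ , at₄ , at₃

  module _ {R : V G → Set} (H : Hole G) (6≤k : 6 ≤ Hole.len H) (H⊆R : ∀ i → R (Hole.vtx H i)) where
    open Hole H renaming (len to k)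

    ≤-len : ∀ {n} → {{n ≤ 6}} → n ≤ k
    ≤-len {{n≤6}} = ≤-trans n≤6 6≤k

    private instance
      k-nonZero : NonZero k
      k-nonZero = >-nonZero ≤-len

    open Cyclic k

    hole-step : ∀ n → Adj G (vtx (ι n)) (vtx (ι (suc n)))
    hole-step n = proj₂ (induced _ _) (subst (CycAdj k (ι n)) (sym (ι-suc n)) (CycAdj-next (ι n)))

    hole-gap : ∀ n d → 2 ≤ d → suc d < k → ¬ Adj G (vtx (ι n)) (vtx (ι (d + n)))
    hole-gap n d 2≤d d+1<k adj with CycAdj⇒next (proj₁ (induced _ _) adj)
    ... | inj₁ ι[d+n]≡next = <⇒≢ 2≤d (sym (ι-cancelʳ n d<k (<-trans 2≤d d<k) (trans ι[d+n]≡next (sym (ι-suc n)))))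
      where d<k = <-trans (n<1+n d) d+1<k
    ... | inj₂ ι[n]≡next with ι-cancelʳ n ≤-len d+1<k (trans ι[n]≡next (sym (ι-suc (d + n))))
    ...   | ()

    hole-walk : ∀ {m} → ℕ → Window R m
    hole-walk c = record
      { at   = λ i → vtx (ι (i + c))
      ; inR  = λ i → H⊆R _
      ; step = λ i → hole-step (i + c)
      ; gap  = λ i d {{2≤d}} {{d≤4}} → subst (λ j → ¬ Adj G (vtx (ι (i + c))) (vtx (ι j))) (sym (+-assoc d i c))
                                          (hole-gap (i + c) d 2≤d (≤-trans (s≤s (s≤s d≤4)) 6≤k))
      }

    window-from : ∀ a → WindowThrough R (vtx a) (vtx (next a)) (vtx (next (next a)))
    window-from a = hole-walk c , cong vtx at₃ , cong vtx at₄ , cong vtx (trans (ι-suc (4 + c)) (cong next at₄))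
      where
        -- adding k first keeps k ∸ 3 from truncating when a < 3
        c = toℕ a + (k ∸ 3)
        at₃ : ι (3 + c) ≡ a
        at₃ = begin
          ι (3 + (toℕ a + (k ∸ 3)))  ≡⟨ cong ι (x∙yz≈y∙xz 3 (toℕ a) (k ∸ 3)) ⟩
          ι (toℕ a + (3 + (k ∸ 3)))  ≡⟨ cong (λ n → ι (toℕ a + n)) (m+[n∸m]≡n ≤-len) ⟩
          ι (toℕ a + k)              ≡⟨ ι-periodic (toℕ a) ⟩
          ι (toℕ a)                  ≡⟨ ι-toℕ a ⟩
          a                          ∎
          where open ≡-Reasoning
        at₄ : ι (4 + c) ≡ next a
        at₄ = trans (ι-suc (3 + c)) (cong next at₃)

    window-on : ∀ {a j b} → CycAdj k a j → CycAdj k j b → a ≢ b → WindowThrough R (vtx a) (vtx j) (vtx b)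
    window-on {a} {j} {b} aj jb a≢b with CycAdj⇒next aj | CycAdj⇒next jb
    ... | inj₁ refl | inj₁ refl = window-from a
    ... | inj₂ refl | inj₂ refl = flip-window (window-from b)
    ... | inj₁ j≡next-a | inj₂ j≡next-b = contradiction (next-injective (trans (sym j≡next-a) j≡next-b)) a≢b
    ... | inj₂ a≡next-j | inj₁ b≡next-j = contradiction (trans a≡next-j (sym b≡next-j)) a≢b

    window-through : ∀ {u v w} → InHole G H u → InHole G H v → InHole G H w →
                     Adj G u v → Adj G v w → u ≢ w → WindowThrough R u v w
    window-through (a , refl) (j , refl) (b , refl) uv vw u≢w =
      window-on (proj₁ (induced a j) uv) (proj₁ (induced j b) vw) (u≢w ∘ cong vtx)

  -- Lᵣ and Lᵣ₋₁ play the top two levels; far-neighbour supplies the neighbour in L_{r-2}.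
  module Core (triangle-free : TriangleFree G) (sunspot-free : SunspotFree4 G)
              {Lᵣ Lᵣ₋₁ : V G → Set}
              (parent : ∀ {v} → Lᵣ v → ∃ λ w → Lᵣ₋₁ w × Adj G v w)
              (far-neighbour : ∀ {w} → Lᵣ₋₁ w → ∃ λ q → Adj G w q × (∀ {v} → Lᵣ v → ¬ Adj G q v)) where

    no-triangle : ∀ {a b c} → Adj G a b → Adj G b c → ¬ Adj G a c
    no-triangle = triangle-free _ _ _

    no-common-lower-neighbour : (W : Window Lᵣ 4) → let open Window W in
                                ∀ {w} → Lᵣ₋₁ w → Adj G w (at 1) → Adj G w (at 3) → ⊥
    no-common-lower-neighbour W {w} w∈ w₁ w₃ with far-neighbour w∈
    ... | q , wq , q-far =
      no-sunspot sunspot-free (at 3) w (at 1) (at 2) (at 4) q (at 0)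
        (Adj-sym w₃) w₁ (step 1) (step 2) (step 3) wq (Adj-sym (step 0))
        (¬Adj-sym (gap 1 2)) (no-triangle w₁ (step 1))
        (¬Adj-sym (q-far (inR 3))) (¬Adj-sym (gap 0 3))
        (no-triangle w₃ (step 3)) (no-triangle w₁ (Adj-sym (step 0)))
        (gap 1 3) (¬Adj-sym (q-far (inR 1)))
        (gap 2 2) (¬Adj-sym (q-far (inR 2))) (¬Adj-sym (gap 0 2))
        (¬Adj-sym (q-far (inR 4))) (¬Adj-sym (gap 0 4)) (q-far (inR 0))
      where open Window W

    skipper-sees-lower-neighbours : (W : Window Lᵣ 6) → let open Window W in
      ∀ {y w} → Adj G y (at 2) → ¬ Adj G y (at 3) → Adj G y (at 4) → Lᵣ₋₁ w → Adj G (at 3) w → Adj G y w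
    skipper-sees-lower-neighbours W {y} {w} y₂ ¬y₃ y₄ w∈ at₃w = decidable-stable (Adj? y w) λ ¬yw →
      no-sunspot sunspot-free (at 2) (at 3) (at 4) y (at 1) w (at 5)
        (step 2) (step 3) (Adj-sym y₄) y₂ (Adj-sym (step 1)) at₃w (step 4)
        (gap 2 2) (¬Adj-sym ¬y₃)
        (no-triangle (step 2) at₃w) (gap 2 3)
        (¬Adj-sym (gap 1 2)) (gap 3 2)
        (¬Adj-sym (gap 1 3)) (no-triangle (Adj-sym (step 3)) at₃w)
        (no-triangle y₂ (Adj-sym (step 1))) ¬yw (no-triangle y₄ (step 4))
        (λ w₁ → no-common-lower-neighbour (subwindow 0 W) w∈ (Adj-sym w₁) (Adj-sym at₃w))
        (gap 1 4)
        (no-common-lower-neighbour (subwindow 2 W) w∈ (Adj-sym at₃w))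
      where open Window W

    skipper-neighbours-meet-window : (W : Window Lᵣ 6) → let open Window W in
      ∀ {z u} → Lᵣ z → Lᵣ u → Adj G z (at 2) → Adj G z (at 4) → Adj G u z →
      ¬ Adj G u (at 3) → ¬ Adj G u (at 4) → ¬ Adj G u (at 5) → ⊥
    skipper-neighbours-meet-window W {z} {u} z∈ u∈ z₂ z₄ uz ¬u₃ ¬u₄ ¬u₅ with parent (inR 3)
      where open Window W
    ... | s , s∈ , at₃s with far-neighbour s∈
    ...   | q , sq , q-far =
      no-sunspot sunspot-free s z (at 4) (at 3) q u (at 5)
        (Adj-sym zs) z₄ (Adj-sym (step 3)) at₃s sq (Adj-sym uz) (step 4)
        (no-triangle (Adj-sym at₃s) (step 3)) (no-triangle z₄ (Adj-sym (step 3)))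
        (no-triangle (Adj-sym zs) (Adj-sym uz))
        (no-common-lower-neighbour (subwindow 2 W) s∈ (Adj-sym at₃s))
        (¬Adj-sym (q-far z∈)) (no-triangle z₄ (step 4))
        (¬Adj-sym (q-far (inR 4))) (¬Adj-sym ¬u₄)
        (¬Adj-sym (q-far (inR 3))) (¬Adj-sym ¬u₃) (gap 3 2)
        (q-far u∈) (q-far (inR 5)) ¬u₅
      where
        open Window W
        zs : Adj G z s
        zs = skipper-sees-lower-neighbours W z₂ (no-triangle z₄ (Adj-sym (step 3))) z₄ s∈ at₃s

    no-skip : Liberal G Lᵣ → (W : Window Lᵣ 8) → let open Window W in
              ∀ {x} → Lᵣ x → x ≢ at 4 → Adj G x (at 3) → ¬ Adj G x (at 4) → Adj G x (at 5) → ⊥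
    no-skip liberal W {x} x∈ x≢₄ x₃ ¬x₄ x₅
      with parent (inR 4) | liberal (at 4) x (inR 4) x∈ (x≢₄ ∘ sym) (¬Adj-sym ¬x₄)
      where open Window W
    ... | t , t∈ , at₄t | (z , z∈ , at₄z , ¬xz) , (u , u∈ , xu , ¬at₄u) =
      no-sunspot sunspot-free (at 3) (at 4) (at 5) x (at 2) z (at 6)
        (step 3) (step 4) (Adj-sym x₅) x₃ (Adj-sym (step 2)) at₄z (step 5)
        (gap 3 2) (¬Adj-sym ¬x₄)
        (no-triangle (step 3) at₄z) (gap 3 3)
        (¬Adj-sym (gap 2 2)) (gap 4 2)
        (¬Adj-sym (gap 2 3)) (no-triangle (Adj-sym (step 4)) at₄z)
        (no-triangle x₃ (Adj-sym (step 2))) ¬xz (no-triangle x₅ (step 5))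
        (λ at₂z → skipper-neighbours-meet-window (subwindow 0 W) z∈ u∈
                    (Adj-sym at₂z) (Adj-sym at₄z) uz ¬u₃ (¬Adj-sym ¬at₄u) ¬u₅)
        (gap 2 4)
        (λ z₆ → skipper-neighbours-meet-window (subwindow 0 (reverse W)) z∈ u∈
                  z₆ (Adj-sym at₄z) uz ¬u₅ (¬Adj-sym ¬at₄u) ¬u₃)
      where
        open Window W
        ¬u₃ : ¬ Adj G u (at 3)
        ¬u₃ = no-triangle (Adj-sym xu) x₃
        ¬u₅ : ¬ Adj G u (at 5)
        ¬u₅ = no-triangle (Adj-sym xu) x₅
        xt : Adj G x t
        xt = skipper-sees-lower-neighbours (subwindow 1 W) x₃ ¬x₄ x₅ t∈ at₄t
        uz : Adj G u z
        uz = decidable-stable (Adj? u z) λ ¬uz → let q , tq , q-far = far-neighbour t∈ in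
          no-sunspot sunspot-free x t (at 4) (at 3) u q z
            xt (Adj-sym at₄t) (Adj-sym (step 3)) (Adj-sym x₃) xu tq at₄z
            ¬x₄ (no-triangle (Adj-sym at₄t) (Adj-sym (step 3)))
            (¬Adj-sym (q-far x∈)) ¬xz
            (no-triangle (Adj-sym xt) xu) (no-triangle (Adj-sym at₄t) at₄z)
            ¬at₄u (¬Adj-sym (q-far (inR 4)))
            (¬Adj-sym ¬u₃) (¬Adj-sym (q-far (inR 3))) (no-triangle (step 3) at₄z)
            (¬Adj-sym (q-far u∈)) ¬uz (q-far z∈)

    module _ (liberal : Liberal G Lᵣ) (H : Hole G) (6≤k : 6 ≤ Hole.len H) (H⊆Lᵣ : ∀ i → Lᵣ (Hole.vtx H i))
             {x} (x∈ : Lᵣ x) (x∉H : ¬ InHole G H x) where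

      no-skip-in-hole : ∀ {p₀ p₁ p₂} → InHole G H p₀ → InHole G H p₁ → InHole G H p₂ →
                        Adj G p₀ p₁ → Adj G p₁ p₂ → p₀ ≢ p₂ → Adj G x p₀ → ¬ Adj G x p₁ → Adj G x p₂ → ⊥
      no-skip-in-hole p₀∈H p₁∈H p₂∈H p₀p₁ p₁p₂ p₀≢p₂ xp₀ ¬xp₁ xp₂
        with window-through H 6≤k H⊆Lᵣ p₀∈H p₁∈H p₂∈H p₀p₁ p₁p₂ p₀≢p₂
      ... | W , refl , refl , refl = no-skip liberal W x∈ (λ { refl → x∉H p₁∈H }) xp₀ ¬xp₁ xp₂

      no-short-sector : (P : Path G) → IsSector G x H P → ¬ (Path.len P ≤ 2)
      no-short-sector record { len = 0 } (() , _) _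
      no-short-sector record { len = 1 ; induced = induced } (_ , _ , xp₀ , xp₁ , _) _ =
        no-triangle xp₀ (proj₂ (induced fzero (fsuc fzero)) (inj₁ refl)) xp₁
      no-short-sector record { len = 2 ; inj = inj ; induced = induced } (_ , inH , xp₀ , xp₂ , interior) _ =
        no-skip-in-hole (inH fzero) (inH (fsuc fzero)) (inH (fsuc (fsuc fzero)))
          (proj₂ (induced _ _) (inj₁ refl)) (proj₂ (induced _ _) (inj₁ refl)) (λ p₀≡p₂ → case inj p₀≡p₂ of λ ())
          xp₀ (interior (fsuc fzero) z<s (s≤s z<s)) xp₂
      no-short-sector record { len = suc (suc (suc _)) } _ (s≤s (s≤s ()))

module _ {G : Graph} {r : ℕ} {L : Fin (suc r) → V G → Set} (leveling : Leveling G r L) where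

  distant-levels-anticomplete : ∀ {i j u v} → suc (toℕ i) < toℕ j → L i u → L j v → ¬ Adj G u v
  distant-levels-anticomplete {i} {j} i+1<j u∈ v∈ uv =
    case Leveling.consecutive leveling i j _ _ (<⇒≢ i<j ∘ cong toℕ) u∈ v∈ uv of λ
      { (inj₁ i+1≡j) → <-irrefl i+1≡j i+1<j
      ; (inj₂ j+1≡i) → <-asym i<j (subst (toℕ j <_) j+1≡i (n<1+n (toℕ j)))
      }
    where
      i<j : toℕ i < toℕ j
      i<j = <-trans (n<1+n (toℕ i)) i+1<j

module _ {G : Graph} {r : ℕ} {L : Fin (3 + r) → V G → Set} (leveling : Leveling G (2 + r) L) where

  top-parent : ∀ {v} → L (fromℕ (2 + r)) v → ∃ λ w → L (inject₁ (fromℕ (1 + r))) w × Adj G v w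
  top-parent = Leveling.parent leveling (fromℕ (1 + r)) _

  far-from-top : ∀ {w} → L (inject₁ (fromℕ (1 + r))) w →
                 ∃ λ q → Adj G w q × (∀ {v} → L (fromℕ (2 + r)) v → ¬ Adj G q v)
  far-from-top w∈ with Leveling.parent leveling (inject₁ (fromℕ r)) _ w∈
  ... | q , q∈ , wq = q , wq , distant-levels-anticomplete leveling levels-apart q∈
    where
      levels-apart : suc (toℕ (inject₁ (inject₁ (fromℕ r)))) < toℕ (fromℕ (2 + r))
      levels-apart rewrite toℕ-inject₁ (inject₁ (fromℕ r)) | toℕ-inject₁ (fromℕ r) | toℕ-fromℕ r = n<1+n (suc r)

lemma2p5 : (r : ℕ) → 3 ≤ r → (G : Graph) → TriangleFree G → SunspotFree4 G →
    (L : Fin (suc r) → V G → Set) → Leveling G r L → Liberal G (L (fromℕ r)) →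
    (H : Hole G) → 6 ≤ Hole.len H → (∀ i → L (fromℕ r) (Hole.vtx H i)) →
    (x : V G) → L (fromℕ r) x → ¬ InHole G H x →
    (P : Path G) → IsSector G x H P → ¬ (Path.len P ≤ 2)
lemma2p5 _ (s≤s (s≤s _)) G triangle-free sunspot-free L leveling liberal H 6≤k H⊆Lᵣ x x∈Lᵣ x∉H =
  no-short-sector liberal H 6≤k H⊆Lᵣ x∈Lᵣ x∉H
  where open Core G triangle-free sunspot-free (top-parent leveling) (far-from-top leveling)
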